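{- Let $k\geqslant 2$ and $1\leqslant d\leqslant k-1$. For every $n\geqslant 0$, $f^{d,k}_n=f^{k-d,k}_n$.
   Context: For permutations $\pi\in\mathfrak S_n$, $\tau\in\mathfrak S_k$, $\pi$ avoids $\tau$ if no subsequence of $\pi$ of length $k$ is order-isomorphic to $\tau$. For $a,b\geqslant1$, $w(a,b)$ denotes the permutation of length $a+b$ given by $(a,a-1,\dots,1,a+b,a+b-1,\dots,a+1)$ (two decreasing layers of lengths $a$ and $b$, all entries of the first layer smaller than those of the second). $T^{d,k}=\{(1,2,3),w(k-d,d)\}$ and $f^{d,k}_n$ is the number of permutations in $\mathfrak S_n$ avoiding both patterns of $T^{d,k}$. -}

module Defs where

open import Data.Nat using (ℕ; zero; suc; _+_; _∸_; _<_; _<ᵇ_)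
open import Data.Bool using (Bool; true; false; _∧_; _∨_; not; if_then_else_)
open import Data.List using (List; []; _∷_; map; concatMap; length; filter; allFin; _++_)
open import Data.Bool.ListAction using (all; any)
open import Data.Fin using (Fin; toℕ)
open import Data.Product using (_×_; _,_)
open import Relation.Nullary.Decidable using (yes; no)
open import Data.Nat using (_≟_)

-- A word (sequence of naturals) is a list of ℕ.
-- A permutation π ∈ 𝔖_n is represented in one-line notation (π(1),…,π(n))
-- as a list of length n of values in {1,…,n} that is injective.

wordsOver : ℕ → ℕ → List (List ℕ)
wordsOver m zero = [] ∷ []
wordsOver m (suc len) =
  concatMap (λ (i : Fin m) → map (λ w → suc (toℕ i) ∷ w) (wordsOver m len)) (allFin m)

notIn : ℕ → List ℕ → Bool
notIn x [] = true
notIn x (y ∷ ys) with x ≟ y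
... | yes _ = false
... | no _  = notIn x ys

distinct : List ℕ → Bool
distinct [] = true
distinct (x ∷ xs) = notIn x xs ∧ distinct xs

Sym : ℕ → List (List ℕ)
Sym n = filter (λ w → Data.Bool.T? (distinct w)) (wordsOver n n)
  where import Data.Bool

subseqs : List ℕ → List (List ℕ)
subseqs [] = [] ∷ []
subseqs (x ∷ xs) = map (x ∷_) (subseqs xs) ++ subseqs xs

-- order-isomorphism: same length and for all positions i,j: a_i < a_j ⇔ b_i < b_j
sameCmp : ℕ → ℕ → ℕ → ℕ → Bool
sameCmp a a' b b' = if (a <ᵇ a') then (b <ᵇ b') else not (b <ᵇ b')

rowOK : ℕ → ℕ → List ℕ → List ℕ → Bool
rowOK a b [] [] = true
rowOK a b (a' ∷ as) (b' ∷ bs) = sameCmp a a' b b' ∧ sameCmp a' a b' b ∧ rowOK a b as bs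
rowOK a b _ _ = false

orderIso : List ℕ → List ℕ → Bool
orderIso [] [] = true
orderIso (a ∷ as) (b ∷ bs) = rowOK a b as bs ∧ orderIso as bs
orderIso _ _ = false

contains : List ℕ → List ℕ → Bool
contains π τ = any (λ s → orderIso s τ) (subseqs π)

avoids : List ℕ → List ℕ → Bool
avoids π τ = not (contains π τ)

avoidsAll : List ℕ → List (List ℕ) → Bool
avoidsAll π T = all (avoids π) T

down : ℕ → ℕ → List ℕ
down zero from = []
down (suc len) from = from ∷ down len (from ∸ 1)

w : ℕ → ℕ → List ℕ
w a b = down a a ++ down b (a + b)

T : ℕ → ℕ → List (List ℕ)
T d k = (1 ∷ 2 ∷ 3 ∷ []) ∷ w (k ∸ d) d ∷ []

f : ℕ → ℕ → ℕ → ℕ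
f d k n = length (filter (λ π → Data.Bool.T? (avoidsAll π (T d k))) (Sym n))
  where import Data.Bool

-- The reverse complement π ↦ π^rc, π^rc(i) = n + 1 − π(n + 1 − i), is an involution of 𝔖_n, and π
-- contains τ iff π^rc contains τ^rc. As 123^rc = 123 and w(a, b)^rc = w(b, a), it carries the
-- permutations avoiding T^{d,k} onto those avoiding T^{k−d,k}. The counts agree because reversal and
-- complementation permute the words of length n over {1, …, n}: grouping the words by their first
-- (or last) letter, they only reindex a finite sum.

module Submission where

open import Defs hiding (T)
import Defs
open import Data.Nat using (ℕ; zero; suc; _+_; _∸_; _≤_; _<_; z≤n; s≤s; _<ᵇ_; _≟_)
open import Data.Nat.Properties
  using ( +-0-commutativeMonoid; +-∸-assoc; +-suc; +-identityʳ; m+n∸n≡m; m+n∸m≡n; m∸[m∸n]≡n; m∸n≤m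
        ; ≤-refl; ≤-trans; m≤m+n; m≤n+m; n≤1+n; m≤n⇒m≤1+n; ∸-monoʳ-<; ∸-monoʳ-≤; ∸-cancelˡ-≡
        ; <⇒≱; ≰⇒>; suc-injective; _<?_)
open import Data.Bool using (Bool; true; false; _∧_; _∨_; not; if_then_else_; T?)
open import Data.Bool.Properties
  using ( ∧-comm; ∧-assoc; ∨-assoc; ∧-identityʳ; ∧-zeroʳ; ∨-identityʳ
        ; ∧-commutativeMonoid; ∨-commutativeMonoid)
open import Data.Bool.ListAction using (and; or; all; any)
open import Data.List using (List; []; _∷_; _++_; _∷ʳ_; [_]; map; concat; length; filter; tabulate; reverse; zip)
open import Data.List.Properties
  using ( filter-++; length-++; map-tabulate; unfold-reverse; length-reverse; length-map; zip-map
        ; map-++; map-∘; map-cong; reverse-++)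
open import Data.List.Relation.Unary.All as All using (All; []; _∷_)
import Data.List.Relation.Unary.All.Properties as All
open import Data.Fin as Fin using (Fin; toℕ; opposite)
open import Data.Fin.Properties using (toℕ<n; opposite-prop)
import Data.Fin.Permutation as Permutation
open import Data.Product using (_×_; _,_)
import Data.Product as Product
open import Data.Empty using (⊥-elim)
open import Relation.Nullary.Decidable using (does; yes; no; dec-true; dec-false; does-⇔)
open import Function using (_∘_; _$_; id; flip; mk⇔)
open import Relation.Binary.PropositionalEquality hiding ([_])
open import Algebra.Bundles using (CommutativeMonoid)
open import Algebra.Properties.CommutativeMonoid.Sum +-0-commutativeMonoid
  using (sum-syntax; ∑-comm; ∑-permute; sum-cong-≗)
import Algebra.Properties.CommutativeSemigroup as CommutativeSemigroupProperties

-- On 𝔖_n, reverseComplement (n + 1) is π ↦ π^rc. Since ∸ truncates, the lemmas about it assume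
-- that all entries are ≤ c.
reverseComplement : ℕ → List ℕ → List ℕ
reverseComplement c = reverse ∘ map (c ∸_)

length-reverseComplement : ∀ c xs → length (reverseComplement c xs) ≡ length xs
length-reverseComplement c xs = trans (length-reverse (map (c ∸_) xs)) (length-map (c ∸_) xs)

reverseComplement-++ : ∀ c xs ys →
                       reverseComplement c (xs ++ ys) ≡ reverseComplement c ys ++ reverseComplement c xs
reverseComplement-++ c xs ys = trans (cong reverse (map-++ (c ∸_) xs ys)) (reverse-++ (map (c ∸_) xs) (map (c ∸_) ys))

-- Counting words

count : {A : Set} → (A → Bool) → List A → ℕ
count p xs = length (filter (T? ∘ p) xs)

module _ {A : Set} where

  count-++ : (p : A → Bool) (xs ys : List A) → count p (xs ++ ys) ≡ count p xs + count p ys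
  count-++ p xs ys = trans (cong length (filter-++ (T? ∘ p) xs ys)) (length-++ (filter (T? ∘ p) xs))

  count-congᴬ : (p q : A → Bool) {xs : List A} → All (λ x → p x ≡ q x) xs → count p xs ≡ count q xs
  count-congᴬ p q [] = refl
  count-congᴬ p q {x ∷ _} (px≡qx ∷ eqs) rewrite px≡qx with q x
  ... | true  = cong suc (count-congᴬ p q eqs)
  ... | false = count-congᴬ p q eqs

  count-cong : {p q : A → Bool} → (∀ x → p x ≡ q x) → (xs : List A) → count p xs ≡ count q xs
  count-cong p≗q xs = count-congᴬ _ _ (All.universal p≗q xs)

  count-filter : (p q : A → Bool) (xs : List A) →
                 length (filter (T? ∘ p) (filter (T? ∘ q) xs)) ≡ count (λ x → q x ∧ p x) xs
  count-filter p q [] = refl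
  count-filter p q (x ∷ xs) with q x
  ... | false = count-filter p q xs
  ... | true with p x
  ...   | true  = cong suc (count-filter p q xs)
  ...   | false = count-filter p q xs

  count-concat-tabulate : (p : A → Bool) {m : ℕ} (g : Fin m → List A) →
                          count p (concat (tabulate g)) ≡ ∑[ i < m ] count p (g i)
  count-concat-tabulate p {zero} g = refl
  count-concat-tabulate p {suc m} g =
    trans (count-++ p (g Fin.zero) _) (cong (count p (g Fin.zero) +_) (count-concat-tabulate p (g ∘ Fin.suc)))

count-map : {A B : Set} (p : B → Bool) (h : A → B) (xs : List A) → count p (map h xs) ≡ count (p ∘ h) xs
count-map p h [] = refl
count-map p h (x ∷ xs) with p (h x)
... | true  = cong suc (count-map p h xs)
... | false = count-map p h xs

wordsOver-suc : ∀ m len →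
                wordsOver m (suc len) ≡ concat (tabulate {n = m} (λ i → map (suc (toℕ i) ∷_) (wordsOver m len)))
wordsOver-suc m len = cong concat (map-tabulate {n = m} id (λ i → map (suc (toℕ i) ∷_) (wordsOver m len)))

wordsOver-bounded : ∀ m len → All (All (_≤ m)) (wordsOver m len)
wordsOver-bounded m zero = [] ∷ []
wordsOver-bounded m (suc len) = subst (All (All (_≤ m))) (sym (wordsOver-suc m len)) $
  All.concat⁺ (All.tabulate⁺ (λ i → All.map⁺ (All.map (toℕ<n i ∷_) (wordsOver-bounded m len))))

suc-toℕ-opposite : ∀ {m} (i : Fin m) → suc (toℕ (opposite i)) ≡ m ∸ toℕ i
suc-toℕ-opposite i = trans (cong suc (opposite-prop i)) (sym (+-∸-assoc 1 (toℕ<n i)))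

module _ (m : ℕ) where

  private
    ∑-cong : {g h : Fin m → ℕ} → (∀ i → g i ≡ h i) → ∑[ i < m ] g i ≡ ∑[ i < m ] h i
    ∑-cong = sum-cong-≗

  count-wordsOver-∷ : ∀ len (p : List ℕ → Bool) →
                      count p (wordsOver m (suc len)) ≡
                      ∑[ i < m ] count (λ u → p (suc (toℕ i) ∷ u)) (wordsOver m len)
  count-wordsOver-∷ len p = begin
    count p (wordsOver m (suc len))
      ≡⟨ cong (count p) (wordsOver-suc m len) ⟩
    count p (concat (tabulate prefixed))
      ≡⟨ count-concat-tabulate p prefixed ⟩
    ∑[ i < m ] count p (prefixed i)
      ≡⟨ ∑-cong (λ i → count-map p (suc (toℕ i) ∷_) (wordsOver m len)) ⟩
    ∑[ i < m ] count (λ u → p (suc (toℕ i) ∷ u)) (wordsOver m len) ∎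
    where
    open ≡-Reasoning
    prefixed : Fin m → List (List ℕ)
    prefixed i = map (suc (toℕ i) ∷_) (wordsOver m len)

  count-wordsOver-∷ʳ : ∀ len (p : List ℕ → Bool) →
                       count p (wordsOver m (suc len)) ≡
                       ∑[ i < m ] count (λ u → p (u ∷ʳ suc (toℕ i))) (wordsOver m len)
  -- filter is defined by with, so even on a single word the two counts are not equal by refl.
  count-wordsOver-∷ʳ zero p = trans (count-wordsOver-∷ zero p)
    (∑-cong (λ i → count-congᴬ (λ u → p (suc (toℕ i) ∷ u)) (λ u → p (u ∷ʳ suc (toℕ i))) (refl ∷ [])))
  count-wordsOver-∷ʳ (suc len) p = begin
    count p (wordsOver m (suc (suc len)))
      ≡⟨ count-wordsOver-∷ (suc len) p ⟩
    ∑[ i < m ] count (λ u → p (suc (toℕ i) ∷ u)) (wordsOver m (suc len))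
      ≡⟨ ∑-cong (λ i → count-wordsOver-∷ʳ len (λ u → p (suc (toℕ i) ∷ u))) ⟩
    ∑[ i < m ] ∑[ j < m ] count (λ u → p (suc (toℕ i) ∷ u ∷ʳ suc (toℕ j))) (wordsOver m len)
      ≡⟨ ∑-comm {m} {m} _ ⟩
    ∑[ j < m ] ∑[ i < m ] count (λ u → p (suc (toℕ i) ∷ u ∷ʳ suc (toℕ j))) (wordsOver m len)
      ≡⟨ ∑-cong (λ j → sym (count-wordsOver-∷ len (λ u → p (u ∷ʳ suc (toℕ j))))) ⟩
    ∑[ j < m ] count (λ u → p (u ∷ʳ suc (toℕ j))) (wordsOver m (suc len)) ∎
    where open ≡-Reasoning

  count-wordsOver-reverse : ∀ len (p : List ℕ → Bool) →
                            count (p ∘ reverse) (wordsOver m len) ≡ count p (wordsOver m len)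
  count-wordsOver-reverse zero p = count-congᴬ (p ∘ reverse) p (refl ∷ [])
  count-wordsOver-reverse (suc len) p = begin
    count (p ∘ reverse) (wordsOver m (suc len))
      ≡⟨ count-wordsOver-∷ len (p ∘ reverse) ⟩
    ∑[ i < m ] count (λ u → p (reverse (suc (toℕ i) ∷ u))) (wordsOver m len)
      ≡⟨ ∑-cong (λ i → count-cong (λ u → cong p (unfold-reverse (suc (toℕ i)) u)) (wordsOver m len)) ⟩
    ∑[ i < m ] count (λ u → p (reverse u ∷ʳ suc (toℕ i))) (wordsOver m len)
      ≡⟨ ∑-cong (λ i → count-wordsOver-reverse len (λ u → p (u ∷ʳ suc (toℕ i)))) ⟩
    ∑[ i < m ] count (λ u → p (u ∷ʳ suc (toℕ i))) (wordsOver m len)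
      ≡⟨ count-wordsOver-∷ʳ len p ⟨
    count p (wordsOver m (suc len)) ∎
    where open ≡-Reasoning

  count-wordsOver-complement : ∀ len (p : List ℕ → Bool) →
                               count (p ∘ map (suc m ∸_)) (wordsOver m len) ≡ count p (wordsOver m len)
  count-wordsOver-complement zero p = count-congᴬ (p ∘ map (suc m ∸_)) p (refl ∷ [])
  count-wordsOver-complement (suc len) p = begin
    count (p ∘ map (suc m ∸_)) (wordsOver m (suc len))
      ≡⟨ count-wordsOver-∷ len (p ∘ map (suc m ∸_)) ⟩
    ∑[ i < m ] count (λ u → p ((m ∸ toℕ i) ∷ map (suc m ∸_) u)) (wordsOver m len)
      ≡⟨ ∑-cong (λ i → count-wordsOver-complement len (λ u → p ((m ∸ toℕ i) ∷ u))) ⟩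
    ∑[ i < m ] count (λ u → p ((m ∸ toℕ i) ∷ u)) (wordsOver m len)
      ≡⟨ ∑-cong (λ i → cong (λ h → count (λ u → p (h ∷ u)) (wordsOver m len)) (suc-toℕ-opposite i)) ⟨
    ∑[ i < m ] count (λ u → p (suc (toℕ (opposite i)) ∷ u)) (wordsOver m len)
      ≡⟨ ∑-permute {m} (λ i → count (λ u → p (suc (toℕ i) ∷ u)) (wordsOver m len)) Permutation.reverse ⟨
    ∑[ i < m ] count (λ u → p (suc (toℕ i) ∷ u)) (wordsOver m len)
      ≡⟨ count-wordsOver-∷ len p ⟨
    count p (wordsOver m (suc len)) ∎
    where open ≡-Reasoning

count-wordsOver-reverseComplement : ∀ m len (p : List ℕ → Bool) →
                                    count (p ∘ reverseComplement (suc m)) (wordsOver m len) ≡ count p (wordsOver m len)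
count-wordsOver-reverseComplement m len p =
  trans (count-wordsOver-complement m len (p ∘ reverse)) (count-wordsOver-reverse m len p)

-- Boolean quantifiers over lists

open CommutativeSemigroupProperties (CommutativeMonoid.commutativeSemigroup ∧-commutativeMonoid)
  using () renaming (interchange to ∧-interchange)
open CommutativeSemigroupProperties (CommutativeMonoid.commutativeSemigroup ∨-commutativeMonoid)
  using () renaming (interchange to ∨-interchange)

module _ {A : Set} where

  all-++ : (p : A → Bool) (xs ys : List A) → all p (xs ++ ys) ≡ (all p xs ∧ all p ys)
  all-++ p [] ys = refl
  all-++ p (x ∷ xs) ys = trans (cong (p x ∧_) (all-++ p xs ys)) (sym (∧-assoc (p x) _ _))

  all-∷ʳ : (p : A → Bool) (xs : List A) (y : A) → all p (xs ∷ʳ y) ≡ (all p xs ∧ p y)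
  all-∷ʳ p xs y = trans (all-++ p xs [ y ]) (cong (all p xs ∧_) (∧-identityʳ (p y)))

  all-reverse : (p : A → Bool) (xs : List A) → all p (reverse xs) ≡ all p xs
  all-reverse p [] = refl
  all-reverse p (x ∷ xs) = begin
    all p (reverse (x ∷ xs)) ≡⟨ cong (all p) (unfold-reverse x xs) ⟩
    all p (reverse xs ∷ʳ x)  ≡⟨ all-∷ʳ p (reverse xs) x ⟩
    all p (reverse xs) ∧ p x ≡⟨ cong (_∧ p x) (all-reverse p xs) ⟩
    all p xs ∧ p x           ≡⟨ ∧-comm (all p xs) (p x) ⟩
    all p (x ∷ xs)           ∎
    where open ≡-Reasoning

  all-cong-on : {B : A → Set} {p q : A → Bool} → (∀ {x} → B x → p x ≡ q x) →
                {xs : List A} → All B xs → all p xs ≡ all q xs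
  all-cong-on p≗q [] = refl
  all-cong-on p≗q (bx ∷ bxs) = cong₂ _∧_ (p≗q bx) (all-cong-on p≗q bxs)

  any-++ : (p : A → Bool) (xs ys : List A) → any p (xs ++ ys) ≡ (any p xs ∨ any p ys)
  any-++ p [] ys = refl
  any-++ p (x ∷ xs) ys = trans (cong (p x ∨_) (any-++ p xs ys)) (sym (∨-assoc (p x) _ _))

  any-cong-on : {B : A → Set} {p q : A → Bool} → (∀ {x} → B x → p x ≡ q x) →
                {xs : List A} → All B xs → any p xs ≡ any q xs
  any-cong-on p≗q [] = refl
  any-cong-on p≗q (bx ∷ bxs) = cong₂ _∨_ (p≗q bx) (any-cong-on p≗q bxs)

  allPairs : (A → A → Bool) → List A → Bool
  allPairs r [] = true
  allPairs r (x ∷ xs) = all (r x) xs ∧ allPairs r xs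

  allPairs-∷ʳ : (r : A → A → Bool) (xs : List A) (y : A) →
                allPairs r (xs ∷ʳ y) ≡ (allPairs r xs ∧ all (λ x → r x y) xs)
  allPairs-∷ʳ r [] y = refl
  allPairs-∷ʳ r (x ∷ xs) y = begin
    all (r x) (xs ∷ʳ y) ∧ allPairs r (xs ∷ʳ y)
      ≡⟨ cong₂ _∧_ (all-∷ʳ (r x) xs y) (allPairs-∷ʳ r xs y) ⟩
    (all (r x) xs ∧ r x y) ∧ (allPairs r xs ∧ all (λ z → r z y) xs)
      ≡⟨ ∧-interchange (all (r x) xs) (r x y) (allPairs r xs) _ ⟩
    (all (r x) xs ∧ allPairs r xs) ∧ (r x y ∧ all (λ z → r z y) xs) ∎
    where open ≡-Reasoning

  allPairs-reverse : (r : A → A → Bool) (xs : List A) → allPairs r (reverse xs) ≡ allPairs (flip r) xs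
  allPairs-reverse r [] = refl
  allPairs-reverse r (x ∷ xs) = begin
    allPairs r (reverse (x ∷ xs))
      ≡⟨ cong (allPairs r) (unfold-reverse x xs) ⟩
    allPairs r (reverse xs ∷ʳ x)
      ≡⟨ allPairs-∷ʳ r (reverse xs) x ⟩
    allPairs r (reverse xs) ∧ all (λ z → r z x) (reverse xs)
      ≡⟨ cong₂ _∧_ (allPairs-reverse r xs) (all-reverse (λ z → r z x) xs) ⟩
    allPairs (flip r) xs ∧ all (flip r x) xs
      ≡⟨ ∧-comm (allPairs (flip r) xs) _ ⟩
    allPairs (flip r) (x ∷ xs) ∎
    where open ≡-Reasoning

  allPairs-cong-on : {B : A → Set} {r s : A → A → Bool} → (∀ {x y} → B x → B y → r x y ≡ s x y) →
                     {xs : List A} → All B xs → allPairs r xs ≡ allPairs s xs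
  allPairs-cong-on r≗s [] = refl
  allPairs-cong-on r≗s (bx ∷ bxs) = cong₂ _∧_ (all-cong-on (r≗s bx) bxs) (allPairs-cong-on r≗s bxs)

module _ {A B : Set} where

  all-map : (p : B → Bool) (g : A → B) (xs : List A) → all p (map g xs) ≡ all (p ∘ g) xs
  all-map p g xs = cong and (sym (map-∘ xs))

  any-map : (p : B → Bool) (g : A → B) (xs : List A) → any p (map g xs) ≡ any (p ∘ g) xs
  any-map p g xs = cong or (sym (map-∘ xs))

  allPairs-map : (r : B → B → Bool) (g : A → B) (xs : List A) →
                 allPairs r (map g xs) ≡ allPairs (λ x y → r (g x) (g y)) xs
  allPairs-map r g [] = refl
  allPairs-map r g (x ∷ xs) = cong₂ _∧_ (all-map (r (g x)) g xs) (allPairs-map r g xs)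

-- Distinctness, order-isomorphism and containment under reverse complement

_≢ᵇ_ : ℕ → ℕ → Bool
x ≢ᵇ y = not (does (x ≟ y))

notIn-all : (x : ℕ) (xs : List ℕ) → notIn x xs ≡ all (x ≢ᵇ_) xs
notIn-all x [] = refl
notIn-all x (y ∷ ys) with x ≟ y
... | yes x≡y = cong (λ b → not b ∧ all (x ≢ᵇ_) ys) (sym (dec-true (x ≟ y) x≡y))
... | no x≢y  = trans (notIn-all x ys) (cong (λ b → not b ∧ all (x ≢ᵇ_) ys) (sym (dec-false (x ≟ y) x≢y)))

distinct-allPairs : (xs : List ℕ) → distinct xs ≡ allPairs _≢ᵇ_ xs
distinct-allPairs [] = refl
distinct-allPairs (x ∷ xs) = cong₂ _∧_ (notIn-all x xs) (distinct-allPairs xs)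

≢ᵇ-complement : ∀ {c a b} → a ≤ c → b ≤ c → ((c ∸ b) ≢ᵇ (c ∸ a)) ≡ (a ≢ᵇ b)
≢ᵇ-complement {c} {a} {b} a≤c b≤c =
  cong not (does-⇔ (mk⇔ (sym ∘ ∸-cancelˡ-≡ b≤c a≤c) (cong (c ∸_) ∘ sym))
                   ((c ∸ b) ≟ (c ∸ a)) (a ≟ b))

distinct-reverseComplement : ∀ c {xs} → All (_≤ c) xs → distinct (reverseComplement c xs) ≡ distinct xs
distinct-reverseComplement c {xs} xs≤c = begin
  distinct (reverse (map (c ∸_) xs))
    ≡⟨ distinct-allPairs (reverse (map (c ∸_) xs)) ⟩
  allPairs _≢ᵇ_ (reverse (map (c ∸_) xs))
    ≡⟨ allPairs-reverse _≢ᵇ_ (map (c ∸_) xs) ⟩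
  allPairs (flip _≢ᵇ_) (map (c ∸_) xs)
    ≡⟨ allPairs-map (flip _≢ᵇ_) (c ∸_) xs ⟩
  allPairs (λ a b → (c ∸ b) ≢ᵇ (c ∸ a)) xs
    ≡⟨ allPairs-cong-on ≢ᵇ-complement xs≤c ⟩
  allPairs _≢ᵇ_ xs
    ≡⟨ distinct-allPairs xs ⟨
  distinct xs ∎
  where open ≡-Reasoning

<ᵇ-complement : ∀ {c a a′} → a ≤ c → a′ ≤ c → ((c ∸ a) <ᵇ (c ∸ a′)) ≡ (a′ <ᵇ a)
<ᵇ-complement {c} {a} {a′} a≤c a′≤c =
  does-⇔ (mk⇔ reflect (λ a′<a → ∸-monoʳ-< a′<a a≤c)) ((c ∸ a) <? (c ∸ a′)) (a′ <? a)
  where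
  reflect : c ∸ a < c ∸ a′ → a′ < a
  reflect lt = ≰⇒> (λ a≤a′ → <⇒≱ lt (∸-monoʳ-≤ c a≤a′))

sameCmp-complement : ∀ {c c′ a a′ b b′} → a ≤ c → a′ ≤ c → b ≤ c′ → b′ ≤ c′ →
                     sameCmp (c ∸ a′) (c ∸ a) (c′ ∸ b′) (c′ ∸ b) ≡ sameCmp a a′ b b′
sameCmp-complement a≤c a′≤c b≤c′ b′≤c′ =
  cong₂ (λ x y → if x then y else not y) (<ᵇ-complement a′≤c a≤c) (<ᵇ-complement b′≤c′ b≤c′)

sameOrder : ℕ × ℕ → ℕ × ℕ → Bool
sameOrder (a , b) (a′ , b′) = sameCmp a a′ b b′ ∧ sameCmp a′ a b′ b

complementPair : ℕ → ℕ → ℕ × ℕ → ℕ × ℕ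
complementPair c c′ = Product.map (c ∸_) (c′ ∸_)

PairBelow : ℕ → ℕ → ℕ × ℕ → Set
PairBelow c c′ (a , b) = a ≤ c × b ≤ c′

sameOrder-complement : ∀ {c c′ p q} → PairBelow c c′ p → PairBelow c c′ q →
                       sameOrder (complementPair c c′ q) (complementPair c c′ p) ≡ sameOrder p q
sameOrder-complement (a≤c , b≤c′) (a′≤c , b′≤c′) =
  cong₂ _∧_ (sameCmp-complement a≤c a′≤c b≤c′ b′≤c′) (sameCmp-complement a′≤c a≤c b′≤c′ b≤c′)

rowOK-all : ∀ a b as bs → length as ≡ length bs → rowOK a b as bs ≡ all (sameOrder (a , b)) (zip as bs)
rowOK-all a b [] [] _ = refl
rowOK-all a b (a′ ∷ as) (b′ ∷ bs) eq =
  trans (cong (sameCmp a a′ b b′ ∧_) (cong (sameCmp a′ a b′ b ∧_) (rowOK-all a b as bs (suc-injective eq))))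
        (sym (∧-assoc (sameCmp a a′ b b′) _ _))

orderIso-allPairs : ∀ as bs → length as ≡ length bs → orderIso as bs ≡ allPairs sameOrder (zip as bs)
orderIso-allPairs [] [] _ = refl
orderIso-allPairs (a ∷ as) (b ∷ bs) eq =
  cong₂ _∧_ (rowOK-all a b as bs (suc-injective eq)) (orderIso-allPairs as bs (suc-injective eq))

orderIso-length : ∀ as bs → length as ≢ length bs → orderIso as bs ≡ false
orderIso-length [] [] ne = ⊥-elim (ne refl)
orderIso-length [] (_ ∷ _) _ = refl
orderIso-length (_ ∷ _) [] _ = refl
orderIso-length (a ∷ as) (b ∷ bs) ne =
  trans (cong (rowOK a b as bs ∧_) (orderIso-length as bs (ne ∘ cong suc))) (∧-zeroʳ (rowOK a b as bs))

module _ {A B : Set} where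

  zip-∷ʳ : {xs : List A} {ys : List B} (x : A) (y : B) → length xs ≡ length ys →
           zip (xs ∷ʳ x) (ys ∷ʳ y) ≡ zip xs ys ∷ʳ (x , y)
  zip-∷ʳ {[]} {[]} x y _ = refl
  zip-∷ʳ {x′ ∷ xs} {y′ ∷ ys} x y eq = cong ((x′ , y′) ∷_) (zip-∷ʳ x y (suc-injective eq))

  zip-reverse : (xs : List A) (ys : List B) → length xs ≡ length ys →
                zip (reverse xs) (reverse ys) ≡ reverse (zip xs ys)
  zip-reverse [] [] _ = refl
  zip-reverse (x ∷ xs) (y ∷ ys) eq = begin
    zip (reverse (x ∷ xs)) (reverse (y ∷ ys))
      ≡⟨ cong₂ zip (unfold-reverse x xs) (unfold-reverse y ys) ⟩
    zip (reverse xs ∷ʳ x) (reverse ys ∷ʳ y)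
      ≡⟨ zip-∷ʳ x y (trans (length-reverse xs) (trans (suc-injective eq) (sym (length-reverse ys)))) ⟩
    zip (reverse xs) (reverse ys) ∷ʳ (x , y)
      ≡⟨ cong (_∷ʳ (x , y)) (zip-reverse xs ys (suc-injective eq)) ⟩
    reverse (zip xs ys) ∷ʳ (x , y)
      ≡⟨ unfold-reverse (x , y) (zip xs ys) ⟨
    reverse (zip (x ∷ xs) (y ∷ ys)) ∎
    where open ≡-Reasoning

  All-zip : {P : A → Set} {Q : B → Set} {xs : List A} {ys : List B} →
            All P xs → All Q ys → All (λ (x , y) → P x × Q y) (zip xs ys)
  All-zip [] _ = []
  All-zip (_ ∷ _) [] = []
  All-zip (px ∷ pxs) (qy ∷ qys) = (px , qy) ∷ All-zip pxs qys

orderIso-reverseComplement : ∀ c c′ {s t} → All (_≤ c) s → All (_≤ c′) t →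
                             orderIso (reverseComplement c s) (reverseComplement c′ t) ≡ orderIso s t
orderIso-reverseComplement c c′ {s} {t} s≤c t≤c′ with length s ≟ length t
... | no ne = trans (orderIso-length (reverseComplement c s) (reverseComplement c′ t) (ne ∘ rc-lengths))
                    (sym (orderIso-length s t ne))
  where
  rc-lengths : length (reverseComplement c s) ≡ length (reverseComplement c′ t) → length s ≡ length t
  rc-lengths eq = trans (sym (length-reverseComplement c s)) (trans eq (length-reverseComplement c′ t))
... | yes eq = begin
  orderIso (reverse (map (c ∸_) s)) (reverse (map (c′ ∸_) t))
    ≡⟨ orderIso-allPairs (reverse (map (c ∸_) s)) (reverse (map (c′ ∸_) t)) reverse-lengths ⟩
  allPairs sameOrder (zip (reverse (map (c ∸_) s)) (reverse (map (c′ ∸_) t)))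
    ≡⟨ cong (allPairs sameOrder) (zip-reverse (map (c ∸_) s) (map (c′ ∸_) t) map-lengths) ⟩
  allPairs sameOrder (reverse (zip (map (c ∸_) s) (map (c′ ∸_) t)))
    ≡⟨ allPairs-reverse sameOrder (zip (map (c ∸_) s) (map (c′ ∸_) t)) ⟩
  allPairs (flip sameOrder) (zip (map (c ∸_) s) (map (c′ ∸_) t))
    ≡⟨ cong (allPairs (flip sameOrder)) (zip-map (c ∸_) (c′ ∸_) s t) ⟩
  allPairs (flip sameOrder) (map (complementPair c c′) (zip s t))
    ≡⟨ allPairs-map (flip sameOrder) (complementPair c c′) (zip s t) ⟩
  allPairs (λ p q → sameOrder (complementPair c c′ q) (complementPair c c′ p)) (zip s t)
    ≡⟨ allPairs-cong-on sameOrder-complement (All-zip s≤c t≤c′) ⟩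
  allPairs sameOrder (zip s t)
    ≡⟨ orderIso-allPairs s t eq ⟨
  orderIso s t ∎
  where
  open ≡-Reasoning
  map-lengths : length (map (c ∸_) s) ≡ length (map (c′ ∸_) t)
  map-lengths = trans (length-map (c ∸_) s) (trans eq (sym (length-map (c′ ∸_) t)))
  reverse-lengths : length (reverse (map (c ∸_) s)) ≡ length (reverse (map (c′ ∸_) t))
  reverse-lengths = trans (length-reverse (map (c ∸_) s)) (trans map-lengths (sym (length-reverse (map (c′ ∸_) t))))

any-subseqs-∷ : (p : List ℕ → Bool) (y : ℕ) (xs : List ℕ) →
                any p (subseqs (y ∷ xs)) ≡ (any (p ∘ (y ∷_)) (subseqs xs) ∨ any p (subseqs xs))
any-subseqs-∷ p y xs =
  trans (any-++ p (map (y ∷_) (subseqs xs)) (subseqs xs))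
        (cong (_∨ any p (subseqs xs)) (any-map p (y ∷_) (subseqs xs)))

any-subseqs-∷ʳ : (p : List ℕ → Bool) (xs : List ℕ) (x : ℕ) →
                 any p (subseqs (xs ∷ʳ x)) ≡ (any (p ∘ (_∷ʳ x)) (subseqs xs) ∨ any p (subseqs xs))
any-subseqs-∷ʳ p [] x = cong (_∨ (p [] ∨ false)) (sym (∨-identityʳ (p [ x ])))
any-subseqs-∷ʳ p (y ∷ xs) x = begin
  any p (subseqs (y ∷ xs ∷ʳ x))
    ≡⟨ any-subseqs-∷ p y (xs ∷ʳ x) ⟩
  any (p ∘ (y ∷_)) (subseqs (xs ∷ʳ x)) ∨ any p (subseqs (xs ∷ʳ x))
    ≡⟨ cong₂ _∨_ (any-subseqs-∷ʳ (p ∘ (y ∷_)) xs x) (any-subseqs-∷ʳ p xs x) ⟩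
  (any (p ∘ (y ∷_) ∘ (_∷ʳ x)) (subseqs xs) ∨ any (p ∘ (y ∷_)) (subseqs xs)) ∨
  (any (p ∘ (_∷ʳ x)) (subseqs xs) ∨ any p (subseqs xs))
    ≡⟨ ∨-interchange (any (p ∘ (y ∷_) ∘ (_∷ʳ x)) (subseqs xs)) _ _ _ ⟩
  (any (p ∘ (_∷ʳ x) ∘ (y ∷_)) (subseqs xs) ∨ any (p ∘ (_∷ʳ x)) (subseqs xs)) ∨
  (any (p ∘ (y ∷_)) (subseqs xs) ∨ any p (subseqs xs))
    ≡⟨ cong₂ _∨_ (any-subseqs-∷ (p ∘ (_∷ʳ x)) y xs) (any-subseqs-∷ p y xs) ⟨
  any (p ∘ (_∷ʳ x)) (subseqs (y ∷ xs)) ∨ any p (subseqs (y ∷ xs)) ∎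
  where open ≡-Reasoning

any-subseqs-reverse : (p : List ℕ → Bool) (xs : List ℕ) →
                      any p (subseqs (reverse xs)) ≡ any (p ∘ reverse) (subseqs xs)
any-subseqs-reverse p [] = refl
any-subseqs-reverse p (y ∷ xs) = begin
  any p (subseqs (reverse (y ∷ xs)))
    ≡⟨ cong (any p ∘ subseqs) (unfold-reverse y xs) ⟩
  any p (subseqs (reverse xs ∷ʳ y))
    ≡⟨ any-subseqs-∷ʳ p (reverse xs) y ⟩
  any (p ∘ (_∷ʳ y)) (subseqs (reverse xs)) ∨ any p (subseqs (reverse xs))
    ≡⟨ cong₂ _∨_ (any-subseqs-reverse (p ∘ (_∷ʳ y)) xs) (any-subseqs-reverse p xs) ⟩
  any (λ s → p (reverse s ∷ʳ y)) (subseqs xs) ∨ any (p ∘ reverse) (subseqs xs)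
    ≡⟨ cong (λ b → or b ∨ any (p ∘ reverse) (subseqs xs)) (map-cong (cong p ∘ unfold-reverse y) (subseqs xs)) ⟨
  any (p ∘ reverse ∘ (y ∷_)) (subseqs xs) ∨ any (p ∘ reverse) (subseqs xs)
    ≡⟨ any-subseqs-∷ (p ∘ reverse) y xs ⟨
  any (p ∘ reverse) (subseqs (y ∷ xs)) ∎
  where open ≡-Reasoning

subseqs-map : (g : ℕ → ℕ) (xs : List ℕ) → subseqs (map g xs) ≡ map (map g) (subseqs xs)
subseqs-map g [] = refl
subseqs-map g (x ∷ xs) = begin
  map (g x ∷_) (subseqs (map g xs)) ++ subseqs (map g xs)
    ≡⟨ cong (λ ss → map (g x ∷_) ss ++ ss) (subseqs-map g xs) ⟩
  map (g x ∷_) (map (map g) (subseqs xs)) ++ map (map g) (subseqs xs)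
    ≡⟨ cong (_++ map (map g) (subseqs xs)) (trans (sym (map-∘ (subseqs xs))) (map-∘ (subseqs xs))) ⟩
  map (map g) (map (x ∷_) (subseqs xs)) ++ map (map g) (subseqs xs)
    ≡⟨ map-++ (map g) (map (x ∷_) (subseqs xs)) (subseqs xs) ⟨
  map (map g) (subseqs (x ∷ xs)) ∎
  where open ≡-Reasoning

subseqs-All : {B : ℕ → Set} {xs : List ℕ} → All B xs → All (All B) (subseqs xs)
subseqs-All [] = [] ∷ []
subseqs-All (bx ∷ bxs) = All.++⁺ (All.map⁺ (All.map (bx ∷_) (subseqs-All bxs))) (subseqs-All bxs)

contains-reverseComplement : ∀ c c′ {π τ} → All (_≤ c) π → All (_≤ c′) τ →
                             contains (reverseComplement c π) (reverseComplement c′ τ) ≡ contains π τ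
contains-reverseComplement c c′ {π} {τ} π≤c τ≤c′ = begin
  any (λ s → orderIso s τ′) (subseqs (reverse (map (c ∸_) π)))
    ≡⟨ any-subseqs-reverse (λ s → orderIso s τ′) (map (c ∸_) π) ⟩
  any (λ s → orderIso (reverse s) τ′) (subseqs (map (c ∸_) π))
    ≡⟨ cong (any (λ s → orderIso (reverse s) τ′)) (subseqs-map (c ∸_) π) ⟩
  any (λ s → orderIso (reverse s) τ′) (map (map (c ∸_)) (subseqs π))
    ≡⟨ any-map (λ s → orderIso (reverse s) τ′) (map (c ∸_)) (subseqs π) ⟩
  any (λ s → orderIso (reverseComplement c s) τ′) (subseqs π)
    ≡⟨ any-cong-on (λ s≤c → orderIso-reverseComplement c c′ s≤c τ≤c′) (subseqs-All π≤c) ⟩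
  any (λ s → orderIso s τ) (subseqs π) ∎
  where
  open ≡-Reasoning
  τ′ = reverseComplement c′ τ

-- The patterns of T^{d,k}

up : ℕ → ℕ → List ℕ
up zero from = []
up (suc len) from = from ∷ up len (suc from)

up-∷ʳ : ∀ len from → up (suc len) from ≡ up len from ∷ʳ (from + len)
up-∷ʳ zero from = cong [_] (sym (+-identityʳ from))
up-∷ʳ (suc len) from =
  cong (from ∷_) (trans (up-∷ʳ len (suc from)) (cong (up len (suc from) ∷ʳ_) (sym (+-suc from len))))

reverse-up : ∀ len from → reverse (up len from) ≡ down len (from + len ∸ 1)
reverse-up zero from = refl
reverse-up (suc len) from = begin
  reverse (up (suc len) from)             ≡⟨ cong reverse (up-∷ʳ len from) ⟩
  reverse (up len from ∷ʳ (from + len))   ≡⟨ reverse-++ (up len from) [ from + len ] ⟩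
  (from + len) ∷ reverse (up len from)    ≡⟨ cong ((from + len) ∷_) (reverse-up len from) ⟩
  down (suc len) (from + len)             ≡⟨ cong (λ z → down (suc len) (z ∸ 1)) (+-suc from len) ⟨
  down (suc len) (from + suc len ∸ 1)     ∎
  where open ≡-Reasoning

map-complement-down : ∀ {c} len from → len ≤ from → from ≤ c →
                      map (c ∸_) (down len from) ≡ up len (c ∸ from)
map-complement-down zero from _ _ = refl
map-complement-down {c} (suc len) (suc from) (s≤s len≤from) from<c =
  cong ((c ∸ suc from) ∷_) (trans (map-complement-down len from len≤from (≤-trans (n≤1+n from) from<c))
                                  (cong (up len) (+-∸-assoc 1 from<c)))

reverseComplement-down : ∀ {c} len from → len ≤ from → from ≤ c →
                         reverseComplement c (down len from) ≡ down len (c ∸ from + len ∸ 1)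
reverseComplement-down {c} len from len≤from from≤c =
  trans (cong reverse (map-complement-down len from len≤from from≤c)) (reverse-up len (c ∸ from))

w-reverseComplement : ∀ a b → reverseComplement (suc (a + b)) (w a b) ≡ w b a
w-reverseComplement a b = begin
  reverseComplement (suc (a + b)) (down a a ++ down b (a + b))
    ≡⟨ reverseComplement-++ (suc (a + b)) (down a a) (down b (a + b)) ⟩
  reverseComplement (suc (a + b)) (down b (a + b)) ++ reverseComplement (suc (a + b)) (down a a)
    ≡⟨ cong₂ _++_ (reverseComplement-down b (a + b) (m≤n+m b a) (n≤1+n (a + b)))
                  (reverseComplement-down a a ≤-refl (m≤n⇒m≤1+n (m≤m+n a b))) ⟩
  down b (suc (a + b) ∸ (a + b) + b ∸ 1) ++ down a (suc (a + b) ∸ a + a ∸ 1)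
    ≡⟨ cong₂ (λ x y → down b (x + b ∸ 1) ++ down a (y + a ∸ 1)) (m+n∸n≡m 1 (a + b)) suc[a+b]∸a ⟩
  down b b ++ down a (b + a) ∎
  where
  open ≡-Reasoning
  suc[a+b]∸a : suc (a + b) ∸ a ≡ suc b
  suc[a+b]∸a = trans (cong (_∸ a) (sym (+-suc a b))) (m+n∸m≡n a (suc b))

down-bounded : ∀ {c} len from → from ≤ c → All (_≤ c) (down len from)
down-bounded zero from _ = []
down-bounded (suc len) from from≤c = from≤c ∷ down-bounded len (from ∸ 1) (≤-trans (m∸n≤m from 1) from≤c)

w-bounded : ∀ a b → All (_≤ suc (a + b)) (w a b)
w-bounded a b = All.++⁺ (down-bounded a a (m≤n⇒m≤1+n (m≤m+n a b))) (down-bounded b (a + b) (n≤1+n (a + b)))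

contains-w-reverseComplement : ∀ {c} a b {π} → All (_≤ c) π →
                               contains (reverseComplement c π) (w a b) ≡ contains π (w b a)
contains-w-reverseComplement {c} a b {π} π≤c = begin
  contains (reverseComplement c π) (w a b)
    ≡⟨ cong (contains (reverseComplement c π)) (w-reverseComplement b a) ⟨
  contains (reverseComplement c π) (reverseComplement (suc (b + a)) (w b a))
    ≡⟨ contains-reverseComplement c (suc (b + a)) π≤c (w-bounded b a) ⟩
  contains π (w b a) ∎
  where open ≡-Reasoning

contains-123-reverseComplement : ∀ {c π} → All (_≤ c) π →
                                 contains (reverseComplement c π) (1 ∷ 2 ∷ 3 ∷ []) ≡ contains π (1 ∷ 2 ∷ 3 ∷ [])
-- reverseComplement 4 (1 ∷ 2 ∷ 3 ∷ []) reduces to 1 ∷ 2 ∷ 3 ∷ [].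
contains-123-reverseComplement {c} π≤c =
  contains-reverseComplement c 4 π≤c (s≤s z≤n ∷ s≤s (s≤s z≤n) ∷ s≤s (s≤s (s≤s z≤n)) ∷ [])

isAvoider : ℕ → ℕ → List ℕ → Bool
isAvoider d k π = distinct π ∧ avoidsAll π (Defs.T d k)

isAvoider-reverseComplement : ∀ {c d k π} → d ≤ k → All (_≤ c) π →
                              isAvoider d k (reverseComplement c π) ≡ isAvoider (k ∸ d) k π
isAvoider-reverseComplement {c} {d} {k} {π} d≤k π≤c = begin
  isAvoider d k (reverseComplement c π)
    ≡⟨ cong₂ _∧_ (distinct-reverseComplement c π≤c)
                 (cong₂ (λ x y → not x ∧ (not y ∧ true))
                        (contains-123-reverseComplement π≤c)
                        (contains-w-reverseComplement (k ∸ d) d π≤c)) ⟩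
  distinct π ∧ avoidsAll π ((1 ∷ 2 ∷ 3 ∷ []) ∷ w d (k ∸ d) ∷ [])
    ≡⟨ cong (λ e → distinct π ∧ avoidsAll π ((1 ∷ 2 ∷ 3 ∷ []) ∷ w e (k ∸ d) ∷ [])) (m∸[m∸n]≡n d≤k) ⟨
  isAvoider (k ∸ d) k π ∎
  where open ≡-Reasoning

lemma2p1 : (k d : ℕ) → 2 ≤ k → 1 ≤ d → d ≤ k ∸ 1 → (n : ℕ) → f d k n ≡ f (k ∸ d) k n
lemma2p1 k d _ _ d≤k∸1 n = begin
  f d k n
    ≡⟨ count-filter (λ π → avoidsAll π (Defs.T d k)) distinct (wordsOver n n) ⟩
  count (isAvoider d k) (wordsOver n n)
    ≡⟨ count-wordsOver-reverseComplement n n (isAvoider d k) ⟨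
  count (isAvoider d k ∘ reverseComplement (suc n)) (wordsOver n n)
    ≡⟨ count-congᴬ _ _ (All.map (isAvoider-reverseComplement d≤k ∘ All.map m≤n⇒m≤1+n)
                                (wordsOver-bounded n n)) ⟩
  count (isAvoider (k ∸ d) k) (wordsOver n n)
    ≡⟨ count-filter (λ π → avoidsAll π (Defs.T (k ∸ d) k)) distinct (wordsOver n n) ⟨
  f (k ∸ d) k n ∎
  where
  open ≡-Reasoning
  d≤k : d ≤ k
  d≤k = ≤-trans d≤k∸1 (m∸n≤m k 1)
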